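{- Let $G=(V,E)$ be a finite connected simple bipartite graph with parts $B$ and $R$. Let $\alpha:B\rightarrow\mathbb N$ be a function such that $\alpha(v)\in\{2\deg(v)-1,2\deg(v),2\deg(v)+1\}$ for all $v\in B$. Let $R'\subseteq R$ be such that $|R'|+\sum_{v\in B}\alpha(v)$ is even. Then there exists an edge-weighting $\omega:E\rightarrow\{1,2,3\}$ such that (i) $s_\omega(v)$ is even for all $v\in R\setminus R'$, (ii) $s_\omega(v)$ is odd for all $v\in R'$, and (iii) $s_\omega(v)=\alpha(v)$ for all $v\in B$. Moreover, for any fixed path $p=\{v_1,\ldots,v_k\}$ in $G$ with $k\ge 3$ and $v_1,v_k\in B$, the edge-weighting $\omega$ can be chosen to satisfy (i)–(iii) and in addition (iv) $\omega(\{v_1,v_2\})\neq 1$ if $\alpha(v_1)=2\deg(v_1)+1$, and $\omega(\{v_1,v_2\})\neq 3$ otherwise; (v) $\omega(\{v_{i-1},v_i\})+\omega(\{v_i,v_{i+1}\})\in\{3,4,5\}$ for each $1<i<k$ with $v_i\in B$; (vi) $\omega(\{v_{k-1},v_k\})\neq 1$ if $\alpha(v_k)=2\deg(v_k)+1$, and $\omega(\{v_{k-1},v_k\})\neq 3$ otherwise.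
   Context: $\deg(v)$ is the degree of $v$ in $G$. For an edge-weighting $\omega$, $s_\omega(v):=\sum_{w\in N(v)}\omega(\{v,w\})$ is the weighted degree of $v$. The path $p$ is written as its sequence of vertices $v_1,\ldots,v_k$, with consecutive vertices adjacent. -}

module Defs where

open import Data.Nat using (ℕ; zero; suc; _+_; _*_; _∸_; _≤_; _<_)
open import Data.Nat.Divisibility using (_∣_)
open import Data.Bool using (Bool; true; false; if_then_else_)
open import Data.Fin using (Fin; toℕ) renaming (zero to fz; suc to fs)
open import Data.Product using (Σ; _×_; _,_; ∃)
open import Data.Sum using (_⊎_)
open import Function.Definitions using (Injective)
open import Relation.Binary.PropositionalEquality using (_≡_; _≢_)
open import Relation.Binary.Construct.Closure.ReflexiveTransitive using (Star)
open import Relation.Nullary using (¬_)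

sumFin : {n : ℕ} → (Fin n → ℕ) → ℕ
sumFin {zero} f = 0
sumFin {suc n} f = f fz + sumFin {n} (λ i → f (fs i))

record Graph (n : ℕ) : Set where
  field
    adj    : Fin n → Fin n → Bool
    sym    : ∀ u v → adj u v ≡ adj v u
    irrefl : ∀ v → adj v v ≡ false

open Graph public

Adj : {n : ℕ} → Graph n → Fin n → Fin n → Set
Adj G u v = adj G u v ≡ true

Connected : {n : ℕ} → Graph n → Set
Connected G = ∀ u v → Star (Adj G) u v

-- side v ≡ true means v ∈ B, side v ≡ false means v ∈ R.
IsBipartition : {n : ℕ} → Graph n → (Fin n → Bool) → Set
IsBipartition G side = ∀ u v → Adj G u v → side u ≢ side v

deg : {n : ℕ} → Graph n → Fin n → ℕ
deg G v = sumFin (λ u → if adj G v u then 1 else 0)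

-- An edge weighting is represented by a function on ordered pairs; its
-- values on non-edges are irrelevant.
In123 : ℕ → Set
In123 x = (x ≡ 1 ⊎ x ≡ 2) ⊎ x ≡ 3

IsWeighting123 : {n : ℕ} → Graph n → (Fin n → Fin n → ℕ) → Set
IsWeighting123 G ω = ∀ u v → Adj G u v → In123 (ω u v) × ω u v ≡ ω v u

wdeg : {n : ℕ} → Graph n → (Fin n → Fin n → ℕ) → Fin n → ℕ
wdeg G ω v = sumFin (λ u → if adj G v u then ω v u else 0)

Even : ℕ → Set
Even x = 2 ∣ x

Odd : ℕ → Set
Odd x = ¬ (2 ∣ x)

card : {n : ℕ} → (Fin n → Bool) → ℕ
card P = sumFin (λ v → if P v then 1 else 0)

sumOver : {n : ℕ} → (Fin n → Bool) → (Fin n → ℕ) → ℕ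
sumOver P α = sumFin (λ v → if P v then α v else 0)

IsPath : {n k : ℕ} → Graph n → (Fin k → Fin n) → Set
IsPath G p = Injective _≡_ _≡_ p ×
             (∀ i j → toℕ j ≡ suc (toℕ i) → Adj G (p i) (p j))

Good : {n : ℕ} → Graph n → (side R' : Fin n → Bool) → (α : Fin n → ℕ) →
       (Fin n → Fin n → ℕ) → Set
Good G side R' α ω =
  IsWeighting123 G ω ×
  (∀ v → side v ≡ false → R' v ≡ false → Even (wdeg G ω v)) ×
  (∀ v → R' v ≡ true → Odd (wdeg G ω v)) ×
  (∀ v → side v ≡ true → wdeg G ω v ≡ α v)

EndOK : {n : ℕ} → Graph n → (α : Fin n → ℕ) → Fin n → ℕ → Set
EndOK G α x c = (α x ≡ 2 * deg G x + 1 → c ≢ 1) × (α x ≢ 2 * deg G x + 1 → c ≢ 3)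

In345 : ℕ → Set
In345 x = (x ≡ 3 ⊎ x ≡ 4) ⊎ x ≡ 5

-- Conditions (iv)-(vi) for a path p = v_1..v_k (indices 0..k-1).
PathOK : {n k : ℕ} → Graph n → (side : Fin n → Bool) → (α : Fin n → ℕ) →
         (Fin k → Fin n) → (Fin n → Fin n → ℕ) → Set
PathOK {k = k} G side α p ω =
  (∀ a b → toℕ a ≡ 0 → toℕ b ≡ 1 → EndOK G α (p a) (ω (p a) (p b))) ×
  (∀ h i j → toℕ i ≡ suc (toℕ h) → toℕ j ≡ suc (toℕ i) → side (p i) ≡ true →
     In345 (ω (p h) (p i) + ω (p i) (p j))) ×
  (∀ a b → suc (toℕ a) ≡ toℕ b → suc (toℕ b) ≡ k → EndOK G α (p b) (ω (p a) (p b)))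

{-# OPTIONS --safe #-}
-- Let T consist of the vertices whose weighted degree must be odd: the b ∈ B with α(b) odd,
-- and R'.  The parity hypothesis says |T| is even, so the connected graph has a T-join J
-- (the mod-2 sum of walks from each vertex of T to a fixed root).  Edges outside J get
-- weight 2, edges of J weight 1 or 3, so every vertex of R gets the prescribed parity.  At
-- b ∈ B the number of J-edges is ≡ α(b) mod 2; giving them alternately 3 and 1, starting
-- with 3 iff α(b) = 2 deg(b) + 1, makes s(b) = 2 deg(b) + (#3 − #1) = α(b).  Weights are
-- chosen at the B-end of each edge.
-- For the path, each B-vertex starts the alternation with its path edges, predecessor first
-- (successor for v_1): the first weight is then 3 or 2 exactly when α = 2 deg + 1, giving
-- (iv) and (vi), and two consecutive path edges are never both 1 or both 3, giving (v).
module Submission where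

open import Defs hiding (sym)
open import Algebra.Bundles using (CommutativeMonoid; CommutativeRing)
open import Data.Nat using (ℕ; zero; suc; _+_; _*_; _∸_; _≤_; _<?_) renaming (_≟_ to _≟ℕ_)
import Data.Nat.Properties as ℕ
open import Data.Nat.Divisibility using (divides)
open import Data.Bool using (Bool; true; false; not; _∧_; _xor_; if_then_else_)
open import Data.Bool.Properties
  using (xor-assoc; xor-comm; xor-same; xor-identityʳ; ∧-assoc; ∧-comm; ∧-identityʳ; ∧-zeroʳ;
         ∧-distribˡ-xor; not-distribˡ-xor; not-involutive; if-float; ∧-commutativeMonoid; xor-∧-commutativeRing)
open import Algebra.Properties.CommutativeSemigroup (CommutativeMonoid.commutativeSemigroup ∧-commutativeMonoid)
  using () renaming (x∙yz≈y∙xz to ∧-exchange)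
open import Data.Fin using (Fin; toℕ; fromℕ<) renaming (zero to fz; suc to fs)
open import Data.Fin.Properties using (_≟_; any?; fromℕ<-toℕ; toℕ<n)
open import Data.Integer using (ℤ; +_; 0ℤ; 1ℤ; -1ℤ) renaming (_+_ to _+ℤ_)
import Data.Integer.Properties as ℤ
open import Data.List using (List; []; _∷_; _++_; allFin; mapMaybe)
open import Data.List.Membership.Propositional using (_∈_)
open import Data.List.Membership.Propositional.Properties using (∈-allFin; ∈-++⁺ʳ)
open import Data.List.Relation.Unary.Any using (here; there)
open import Data.Maybe using (Maybe; just; nothing; maybe′)
open import Data.Product using (_×_; _,_; ∃; proj₁; proj₂)
open import Data.Sum using (_⊎_; inj₁; inj₂)
open import Function using (_∘_)
open import Function.Definitions using (Injective)
open import Relation.Binary.PropositionalEquality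
  using (_≡_; _≢_; refl; sym; trans; cong; cong₂; subst; module ≡-Reasoning)
open import Relation.Binary.Construct.Closure.ReflexiveTransitive using (Star; ε; _◅_)
open import Relation.Nullary using (yes; no; does; contradiction)
open import Relation.Nullary.Decidable using (dec-true; dec-false)

-- Finite sums

module PointSum {c ℓ} (M : CommutativeMonoid c ℓ) where
  open CommutativeMonoid M renaming (ε to 0#; sym to ≈-sym; trans to ≈-trans; reflexive to ≈-reflexive)
  open import Algebra.Properties.CommutativeMonoid.Sum M
  open import Relation.Binary.Reasoning.Setoid setoid

  sum-δ : ∀ {n} (f : Fin n → Carrier) x → sum (λ u → if does (u ≟ x) then f u else 0#) ≈ f x
  sum-δ {suc n} f fz = ≈-trans (∙-congˡ (sum-replicate-zero n)) (identityʳ (f fz))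
  sum-δ {suc n} f (fs x) = ≈-trans (identityˡ _) (sum-δ (f ∘ fs) x)

  sum-zero : ∀ {n} {f : Fin n → Carrier} → (∀ u → f u ≡ 0#) → sum f ≈ 0#
  sum-zero {n} f≡0 = ≈-trans (≈-reflexive (sum-cong-≗ f≡0)) (sum-replicate-zero n)

  sum-splitAt : ∀ {n} (f : Fin n → Carrier) x →
                sum f ≈ f x ∙ sum (λ u → if does (u ≟ x) then 0# else f u)
  sum-splitAt f x = begin
    sum f                       ≈⟨ sum-cong-≋ split ⟩
    sum (λ u → at u ∙ off u)    ≈⟨ ∑-distrib-+ at off ⟩
    sum at ∙ sum off            ≈⟨ ∙-congʳ (sum-δ f x) ⟩
    f x ∙ sum off               ∎
    where
    at off : Fin _ → Carrier
    at u = if does (u ≟ x) then f u else 0#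
    off u = if does (u ≟ x) then 0# else f u
    split : ∀ u → f u ≈ at u ∙ off u
    split u with does (u ≟ x)
    ... | true = ≈-sym (identityʳ (f u))
    ... | false = ≈-sym (identityˡ (f u))

module ⊕ where
  open import Algebra.Properties.Semiring.Sum (CommutativeRing.semiring xor-∧-commutativeRing) public
  open PointSum (CommutativeRing.+-commutativeMonoid xor-∧-commutativeRing) public

  sum-∧δ : ∀ {n} (f : Fin n → Bool) x → sum (λ u → f u ∧ does (u ≟ x)) ≡ f x
  sum-∧δ f x = trans (sum-cong-≗ as-if) (sum-δ f x)
    where
    as-if : ∀ u → f u ∧ does (u ≟ x) ≡ (if does (u ≟ x) then f u else false)
    as-if u with does (u ≟ x)
    ... | true = ∧-identityʳ (f u)
    ... | false = ∧-zeroʳ (f u)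

does-≟-sym : ∀ {n} (x y : Fin n) → does (x ≟ y) ≡ does (y ≟ x)
does-≟-sym x y with x ≟ y
... | yes refl = sym (dec-true (x ≟ x) refl)
... | no x≢y = sym (dec-false (y ≟ x) (x≢y ∘ sym))

xor-telescope : ∀ x y z → (x xor y) xor (y xor z) ≡ x xor z
xor-telescope x y z = begin
  (x xor y) xor (y xor z)   ≡⟨ xor-assoc x y (y xor z) ⟩
  x xor (y xor (y xor z))   ≡⟨ cong (x xor_) (sym (xor-assoc y y z)) ⟩
  x xor ((y xor y) xor z)   ≡⟨ cong (λ w → x xor (w xor z)) (xor-same y) ⟩
  x xor z                   ∎
  where open ≡-Reasoning

-- T-joins

record TJoin {n : ℕ} (G : Graph n) (T : Fin n → Bool) : Set where
  field
    join        : Fin n → Fin n → Bool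
    join-sym    : ∀ u v → join u v ≡ join v u
    join-degree : ∀ v → ⊕.sum (λ u → adj G v u ∧ join v u) ≡ T v

module Walks {n : ℕ} (G : Graph n) where

  edgeIndicator : Fin n → Fin n → Fin n → Fin n → Bool
  edgeIndicator a b u v = (does (u ≟ a) ∧ does (v ≟ b)) xor (does (u ≟ b) ∧ does (v ≟ a))

  oddEdges : ∀ {a b} → Star (Adj G) a b → Fin n → Fin n → Bool
  oddEdges ε u v = false
  oddEdges (_◅_ {a} {b} _ w) u v = edgeIndicator a b u v xor oddEdges w u v

  edgeIndicator-sym : ∀ a b u v → edgeIndicator a b u v ≡ edgeIndicator a b v u
  edgeIndicator-sym a b u v =
    trans (xor-comm (does (u ≟ a) ∧ does (v ≟ b)) _)
          (cong₂ _xor_ (∧-comm (does (u ≟ b)) _) (∧-comm (does (u ≟ a)) _))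

  oddEdges-sym : ∀ {a b} (w : Star (Adj G) a b) u v → oddEdges w u v ≡ oddEdges w v u
  oddEdges-sym ε u v = refl
  oddEdges-sym (_◅_ {a} {b} _ w) u v = cong₂ _xor_ (edgeIndicator-sym a b u v) (oddEdges-sym w u v)

  adj-∧-≟ : ∀ {a b} → Adj G a b → ∀ v → adj G v b ∧ does (v ≟ a) ≡ does (v ≟ a)
  adj-∧-≟ {a} ab v with v ≟ a
  ... | yes refl = trans (∧-identityʳ _) ab
  ... | no _ = ∧-zeroʳ _

  edge-degree : ∀ {a b} → Adj G a b → ∀ v →
                ⊕.sum (λ u → adj G v u ∧ edgeIndicator a b v u) ≡ does (v ≟ a) xor does (v ≟ b)
  edge-degree {a} {b} ab v = begin
    ⊕.sum (λ u → adj G v u ∧ edgeIndicator a b v u)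
      ≡⟨ ⊕.sum-cong-≗ (λ u → ∧-distribˡ-xor (adj G v u) _ _) ⟩
    ⊕.sum (λ u → toward a b u xor toward b a u)
      ≡⟨ ⊕.∑-distrib-+ (toward a b) (toward b a) ⟩
    ⊕.sum (toward a b) xor ⊕.sum (toward b a)
      ≡⟨ cong₂ _xor_ (endpoint ab) (endpoint (trans (Graph.sym G b a) ab)) ⟩
    does (v ≟ a) xor does (v ≟ b)
      ∎
    where
    open ≡-Reasoning
    toward : Fin n → Fin n → Fin n → Bool
    toward x y u = adj G v u ∧ (does (v ≟ x) ∧ does (u ≟ y))
    endpoint : ∀ {x y} → Adj G x y → ⊕.sum (toward x y) ≡ does (v ≟ x)
    endpoint {x} {y} xy =
      trans (⊕.sum-cong-≗ (λ u → sym (∧-assoc (adj G v u) _ _)))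
            (trans (⊕.sum-∧δ (λ u → adj G v u ∧ does (v ≟ x)) y) (adj-∧-≟ xy v))

  walk-degree : ∀ {a b} (w : Star (Adj G) a b) v →
                ⊕.sum (λ u → adj G v u ∧ oddEdges w v u) ≡ does (v ≟ a) xor does (v ≟ b)
  walk-degree {a} ε v =
    trans (⊕.sum-zero (λ u → ∧-zeroʳ (adj G v u))) (sym (xor-same (does (v ≟ a))))
  walk-degree {a} {c} (_◅_ {j = b} ab w) v = begin
    ⊕.sum (λ u → adj G v u ∧ oddEdges (ab ◅ w) v u)
      ≡⟨ ⊕.sum-cong-≗ (λ u → ∧-distribˡ-xor (adj G v u) _ _) ⟩
    ⊕.sum (λ u → (adj G v u ∧ edgeIndicator a b v u) xor (adj G v u ∧ oddEdges w v u))
      ≡⟨ ⊕.∑-distrib-+ (λ u → adj G v u ∧ edgeIndicator a b v u) (λ u → adj G v u ∧ oddEdges w v u) ⟩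
    ⊕.sum (λ u → adj G v u ∧ edgeIndicator a b v u) xor ⊕.sum (λ u → adj G v u ∧ oddEdges w v u)
      ≡⟨ cong₂ _xor_ (edge-degree ab v) (walk-degree w v) ⟩
    (does (v ≟ a) xor does (v ≟ b)) xor (does (v ≟ b) xor does (v ≟ c))
      ≡⟨ xor-telescope (does (v ≟ a)) (does (v ≟ b)) (does (v ≟ c)) ⟩
    does (v ≟ a) xor does (v ≟ c)
      ∎
    where open ≡-Reasoning

tJoin : ∀ {n} (G : Graph n) → Connected G → (T : Fin n → Bool) → ⊕.sum T ≡ false → TJoin G T
tJoin {zero} G _ T _ = record { join = λ _ _ → false ; join-sym = λ () ; join-degree = λ () }
tJoin {suc n} G conn T balanced = record
  { join = J ; join-sym = λ u v → ⊕.sum-cong-≗ (λ t → cong (T t ∧_) (oddEdges-sym (conn t fz) u v))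
  ; join-degree = degree }
  where
  open Walks G
  walk : Fin (suc n) → Fin (suc n) → Fin (suc n) → Bool
  walk t = oddEdges (conn t fz)
  J : Fin (suc n) → Fin (suc n) → Bool
  J u v = ⊕.sum (λ t → T t ∧ walk t u v)
  degree : ∀ v → ⊕.sum (λ u → adj G v u ∧ J v u) ≡ T v
  degree v = begin
    ⊕.sum (λ u → adj G v u ∧ ⊕.sum (λ t → T t ∧ walk t v u))
      ≡⟨ ⊕.sum-cong-≗ (λ u → ⊕.*-distribˡ-sum (adj G v u) (λ t → T t ∧ walk t v u)) ⟩
    ⊕.sum (λ u → ⊕.sum (λ t → adj G v u ∧ (T t ∧ walk t v u)))
      ≡⟨ ⊕.∑-comm (λ u t → adj G v u ∧ (T t ∧ walk t v u)) ⟩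
    ⊕.sum (λ t → ⊕.sum (λ u → adj G v u ∧ (T t ∧ walk t v u)))
      ≡⟨ ⊕.sum-cong-≗ (λ t → ⊕.sum-cong-≗ (λ u → ∧-exchange (adj G v u) (T t) (walk t v u))) ⟩
    ⊕.sum (λ t → ⊕.sum (λ u → T t ∧ (adj G v u ∧ walk t v u)))
      ≡⟨ ⊕.sum-cong-≗ (λ t → sym (⊕.*-distribˡ-sum (T t) (λ u → adj G v u ∧ walk t v u))) ⟩
    ⊕.sum (λ t → T t ∧ ⊕.sum (λ u → adj G v u ∧ walk t v u))
      ≡⟨ ⊕.sum-cong-≗ (λ t → cong (T t ∧_) (walk-degree (conn t fz) v)) ⟩
    ⊕.sum (λ t → T t ∧ (does (v ≟ t) xor does (v ≟ fz)))
      ≡⟨ ⊕.sum-cong-≗ (λ t → ∧-distribˡ-xor (T t) (does (v ≟ t)) (does (v ≟ fz))) ⟩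
    ⊕.sum (λ t → (T t ∧ does (v ≟ t)) xor (T t ∧ does (v ≟ fz)))
      ≡⟨ ⊕.∑-distrib-+ (λ t → T t ∧ does (v ≟ t)) (λ t → T t ∧ does (v ≟ fz)) ⟩
    ⊕.sum (λ t → T t ∧ does (v ≟ t)) xor ⊕.sum (λ t → T t ∧ does (v ≟ fz))
      ≡⟨ cong₂ _xor_ at-v (trans (sym (⊕.*-distribʳ-sum (does (v ≟ fz)) T))
                                  (cong (_∧ does (v ≟ fz)) balanced)) ⟩
    T v xor false
      ≡⟨ xor-identityʳ (T v) ⟩
    T v
      ∎
    where
    open ≡-Reasoning
    at-v : ⊕.sum (λ t → T t ∧ does (v ≟ t)) ≡ T v
    at-v = trans (⊕.sum-cong-≗ (λ t → cong (T t ∧_) (does-≟-sym v t))) (⊕.sum-∧δ T v)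

-- Parity and signed sums

parity : ℕ → Bool
parity zero = false
parity (suc n) = not (parity n)

parity-+ : ∀ m n → parity (m + n) ≡ parity m xor parity n
parity-+ zero n = refl
parity-+ (suc m) n = trans (cong not (parity-+ m n)) (not-distribˡ-xor (parity m) (parity n))

parity-sumFin : ∀ {n} (f : Fin n → ℕ) → parity (sumFin f) ≡ ⊕.sum (parity ∘ f)
parity-sumFin {zero} f = refl
parity-sumFin {suc n} f = trans (parity-+ (f fz) _) (cong (parity (f fz) xor_) (parity-sumFin (f ∘ fs)))

parity-*2 : ∀ q → parity (q * 2) ≡ false
parity-*2 zero = refl
parity-*2 (suc q) = trans (not-involutive _) (parity-*2 q)

parity-2* : ∀ d → parity (2 * d) ≡ false
parity-2* d = trans (cong parity (ℕ.*-comm 2 d)) (parity-*2 d)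

even⇒parity≡false : ∀ {x} → Even x → parity x ≡ false
even⇒parity≡false (divides q refl) = parity-*2 q

parity≡false⇒even : ∀ x → parity x ≡ false → Even x
parity≡false⇒even zero _ = divides 0 refl
parity≡false⇒even (suc (suc x)) p with parity≡false⇒even x (trans (sym (not-involutive (parity x))) p)
... | divides q refl = divides (suc q) refl

parity≡true⇒odd : ∀ {x} → parity x ≡ true → Odd x
parity≡true⇒odd p even with trans (sym p) (even⇒parity≡false even)
... | ()

module Σℤ where
  open import Algebra.Properties.Semiring.Sum ℤ.+-*-semiring public
  open PointSum ℤ.+-0-commutativeMonoid public

+-sumFin : ∀ {n} (f : Fin n → ℕ) → + sumFin f ≡ Σℤ.sum (λ u → + f u)
+-sumFin {zero} f = refl
+-sumFin {suc n} f = trans (ℤ.pos-+ (f fz) _) (cong (+ f fz +ℤ_) (+-sumFin (f ∘ fs)))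

*-distribˡ-sumFin : ∀ {n} k (f : Fin n → ℕ) → k * sumFin f ≡ sumFin (λ u → k * f u)
*-distribˡ-sumFin {zero} k f = ℕ.*-zeroʳ k
*-distribˡ-sumFin {suc n} k f =
  trans (ℕ.*-distribˡ-+ k (f fz) _) (cong (λ x → k * f fz + x) (*-distribˡ-sumFin k (f ∘ fs)))

sign : Bool → ℤ
sign true = 1ℤ
sign false = -1ℤ

imbalance : Bool → Bool → ℤ
imbalance s odd = if odd then sign s else 0ℤ

imbalance-step : ∀ s x b → imbalance s x +ℤ imbalance (s xor x) b ≡ imbalance s (x xor b)
imbalance-step false false false = refl
imbalance-step false false true = refl
imbalance-step false true false = refl
imbalance-step false true true = refl
imbalance-step true false false = refl
imbalance-step true false true = refl
imbalance-step true true false = refl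
imbalance-step true true true = refl

signedSum : ∀ {n} → (Fin n → Bool) → (Fin n → Bool) → ℤ
signedSum c σ = Σℤ.sum (λ u → imbalance (σ u) (c u))

erase : ∀ {n} → Fin n → (Fin n → Bool) → Fin n → Bool
erase q c u = if does (u ≟ q) then false else c u

-- The support of c is signed alternately, starting with s, in the order of the list
-- (a repeated vertex is signed at its first occurrence only).
alternating : ∀ {n} → Bool → List (Fin n) → (Fin n → Bool) → Fin n → Bool
alternating s [] c u = s
alternating s (q ∷ qs) c u = if does (u ≟ q) then s else alternating (s xor c q) qs (erase q c) u

alternating-head : ∀ {n} s (q : Fin n) qs c → alternating s (q ∷ qs) c q ≡ s
alternating-head s q qs c rewrite dec-true (q ≟ q) refl = refl

alternating-second : ∀ {n} s (q q′ : Fin n) qs c → q′ ≢ q →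
                     alternating s (q ∷ q′ ∷ qs) c q′ ≡ s xor c q
alternating-second s q q′ qs c q′≢q
  rewrite dec-false (q′ ≟ q) q′≢q | dec-true (q′ ≟ q′) refl = refl

signedSum-alternating : ∀ {n} s qs (c : Fin n → Bool) → (∀ u → c u ≡ true → u ∈ qs) →
                        signedSum c (alternating s qs c) ≡ imbalance s (⊕.sum c)
signedSum-alternating s [] c covered =
  trans (Σℤ.sum-zero (λ u → cong (imbalance s) (vanishes u)))
        (cong (imbalance s) (sym (⊕.sum-zero vanishes)))
  where
  vanishes : ∀ u → c u ≡ false
  vanishes u with c u in e
  ... | true with () ← covered u e
  ... | false = refl
signedSum-alternating s (q ∷ qs) c covered = begin
  signedSum c σ
    ≡⟨ Σℤ.sum-splitAt (λ u → imbalance (σ u) (c u)) q ⟩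
  imbalance (σ q) (c q) +ℤ Σℤ.sum (λ u → if does (u ≟ q) then 0ℤ else imbalance (σ u) (c u))
    ≡⟨ cong₂ _+ℤ_ (cong (λ t → imbalance t (c q)) (alternating-head s q qs c))
                  (Σℤ.sum-cong-≗ off-q) ⟩
  imbalance s (c q) +ℤ signedSum (erase q c) σ′
    ≡⟨ cong (imbalance s (c q) +ℤ_) (signedSum-alternating (s xor c q) qs (erase q c) covered′) ⟩
  imbalance s (c q) +ℤ imbalance (s xor c q) (⊕.sum (erase q c))
    ≡⟨ imbalance-step s (c q) (⊕.sum (erase q c)) ⟩
  imbalance s (c q xor ⊕.sum (erase q c))
    ≡⟨ cong (imbalance s) (sym (⊕.sum-splitAt c q)) ⟩
  imbalance s (⊕.sum c)
    ∎
  where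
  open ≡-Reasoning
  σ = alternating s (q ∷ qs) c
  σ′ = alternating (s xor c q) qs (erase q c)
  off-q : ∀ u → (if does (u ≟ q) then 0ℤ else imbalance (σ u) (c u)) ≡ imbalance (σ′ u) (erase q c u)
  off-q u with does (u ≟ q)
  ... | true = refl
  ... | false = refl
  covered′ : ∀ u → erase q c u ≡ true → u ∈ qs
  covered′ u e with u ≟ q
  ... | no u≢q with covered u e
  ...   | here u≡q = contradiction u≡q u≢q
  ...   | there u∈qs = u∈qs

-- Edge weights

weight : Bool → Bool → ℕ
weight false _ = 2
weight true false = 1
weight true true = 3

weight-In123 : ∀ j s → In123 (weight j s)
weight-In123 false s = inj₁ (inj₂ refl)
weight-In123 true false = inj₁ (inj₁ refl)
weight-In123 true true = inj₂ refl

parity-weight : ∀ j s → parity (weight j s) ≡ j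
parity-weight false s = refl
parity-weight true false = refl
parity-weight true true = refl

weight-on-edge : ∀ a j s → + (if a then weight j s else 0) ≡ + (if a then 2 else 0) +ℤ imbalance s (a ∧ j)
weight-on-edge false j s = refl
weight-on-edge true false s = refl
weight-on-edge true true false = refl
weight-on-edge true true true = refl

weight-pair-In345 : ∀ c c′ s → In345 (weight c s + weight c′ (s xor c))
weight-pair-In345 false false s = inj₁ (inj₂ refl)
weight-pair-In345 false true false = inj₁ (inj₁ refl)
weight-pair-In345 false true true = inj₂ refl
weight-pair-In345 true false false = inj₁ (inj₁ refl)
weight-pair-In345 true false true = inj₂ refl
weight-pair-In345 true true false = inj₁ (inj₂ refl)
weight-pair-In345 true true true = inj₁ (inj₂ refl)

weight-≟-end : ∀ j {a t : ℕ} →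
               (a ≡ t → weight j (does (a ≟ℕ t)) ≢ 1) × (a ≢ t → weight j (does (a ≟ℕ t)) ≢ 3)
weight-≟-end j {a} {t} =
    (λ a≡t → subst (λ s → weight j s ≢ 1) (sym (dec-true (a ≟ℕ t) a≡t)) (true≢1 j))
  , (λ a≢t → subst (λ s → weight j s ≢ 3) (sym (dec-false (a ≟ℕ t) a≢t)) (false≢3 j))
  where
  true≢1 : ∀ j → weight j true ≢ 1
  true≢1 false ()
  true≢1 true ()
  false≢3 : ∀ j → weight j false ≢ 3
  false≢3 false ()
  false≢3 true ()

imbalance-fits : ∀ a d → ((a ≡ 2 * d ∸ 1 ⊎ a ≡ 2 * d) ⊎ a ≡ 2 * d + 1) →
                 + (2 * d) +ℤ imbalance (does (a ≟ℕ 2 * d + 1)) (parity a) ≡ + a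
imbalance-fits a d (inj₂ refl) =
  trans (cong₂ (λ s p → + (2 * d) +ℤ imbalance s p) (dec-true (a ≟ℕ a) refl) odd)
        (sym (ℤ.pos-+ (2 * d) 1))
  where
  odd : parity (2 * d + 1) ≡ true
  odd = trans (parity-+ (2 * d) 1) (cong (_xor true) (parity-2* d))
imbalance-fits a d (inj₁ (inj₂ refl)) =
  trans (cong (λ p → + (2 * d) +ℤ imbalance (does (a ≟ℕ 2 * d + 1)) p) (parity-2* d)) (ℤ.+-identityʳ (+ a))
imbalance-fits a zero (inj₁ (inj₁ refl)) = imbalance-fits 0 0 (inj₁ (inj₂ refl))
-- Here a = 2(e+1) ∸ 1 satisfies 2(e+1) + 1 = suc (a + 1) and + 2(e+1) + -1 = + a definitionally.
imbalance-fits a (suc e) (inj₁ (inj₁ refl)) =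
  cong₂ (λ s p → + (2 * suc e) +ℤ imbalance s p) (dec-false (a ≟ℕ _) (ℕ.m≢1+m+n a)) odd
  where
  odd : parity (2 * suc e ∸ 1) ≡ true
  odd = trans (cong parity (ℕ.+-suc e (e + 0))) (cong not (parity-2* e))

-- The weighting

module PathPositions {n k : ℕ} (p : Fin k → Fin n) (p-injective : Injective _≡_ _≡_ p) where

  vertexAt : ℕ → Maybe (Fin n)
  vertexAt m with m <? k
  ... | yes m<k = just (p (fromℕ< m<k))
  ... | no _ = nothing

  vertexAt-toℕ : ∀ i {m} → toℕ i ≡ m → vertexAt m ≡ just (p i)
  vertexAt-toℕ i refl with toℕ i <? k
  ... | yes i<k = cong (just ∘ p) (fromℕ<-toℕ i i<k)
  ... | no i≮k = contradiction (toℕ<n i) i≮k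

  position : Fin n → Maybe (Fin k)
  position b with any? (λ i → p i ≟ b)
  ... | yes (i , _) = just i
  ... | no _ = nothing

  position-p : ∀ i → position (p i) ≡ just i
  position-p i with any? (λ j → p j ≟ p i)
  ... | yes (j , pj≡pi) = cong just (p-injective pj≡pi)
  ... | no none = contradiction (i , refl) none

  -- Positions are 0-based: v_1 pins v_2, every later v_i pins v_{i-1} and then v_{i+1}.
  neighbourPositions : ℕ → List ℕ
  neighbourPositions zero = 1 ∷ []
  neighbourPositions (suc i) = i ∷ suc (suc i) ∷ []

  pins : Fin n → List (Fin n)
  pins b = maybe′ (λ i → mapMaybe vertexAt (neighbourPositions (toℕ i))) [] (position b)

  pins-first : ∀ a b → toℕ a ≡ 0 → toℕ b ≡ 1 → ∃ λ qs → pins (p a) ≡ p b ∷ qs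
  pins-first a b a≡0 b≡1 rewrite position-p a | a≡0 | vertexAt-toℕ b b≡1 = _ , refl

  pins-last : ∀ a b → suc (toℕ a) ≡ toℕ b → ∃ λ qs → pins (p b) ≡ p a ∷ qs
  pins-last a b a+1≡b rewrite position-p b | sym a+1≡b | vertexAt-toℕ a refl = _ , refl

  pins-interior : ∀ h i j → toℕ i ≡ suc (toℕ h) → toℕ j ≡ suc (toℕ i) →
                  pins (p i) ≡ p h ∷ p j ∷ []
  pins-interior h i j i≡h+1 j≡i+1
    rewrite position-p i | i≡h+1 | vertexAt-toℕ h refl | vertexAt-toℕ j j≡i+1 = refl

opposite-side : ∀ {n} {G : Graph n} {side : Fin n → Bool} → IsBipartition G side →
                ∀ {u v} → Adj G u v → side v ≡ not (side u)
opposite-side {side = side} bip {u} {v} uv with side u in su | side v in sv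
... | true | false = refl
... | false | true = refl
... | true | true = contradiction (trans su (sym sv)) (bip u v uv)
... | false | false = contradiction (trans su (sym sv)) (bip u v uv)

B-endpoint : ∀ {n} {G : Graph n} {side : Fin n → Bool} → IsBipartition G side →
             ∀ {u v} → Adj G u v → side u ≡ true ⊎ side v ≡ true
B-endpoint {G = G} {side = side} bip {u} uv with side u in su
... | true = inj₁ refl
... | false = inj₂ (trans (opposite-side {G = G} bip uv) (cong not su))

target : ∀ {n} → (side R' : Fin n → Bool) → (Fin n → ℕ) → Fin n → Bool
target side R' α v = if side v then parity (α v) else R' v

target-balanced : ∀ {n} (side R' : Fin n → Bool) (α : Fin n → ℕ) →
                  (∀ v → R' v ≡ true → side v ≡ false) →
                  Even (card R' + sumOver side α) → ⊕.sum (target side R' α) ≡ false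
target-balanced side R' α R'⊆R even = begin
  ⊕.sum (target side R' α)
    ≡⟨ ⊕.sum-cong-≗ (λ v → split (R' v) (side v) (α v) (R'⊆R v)) ⟩
  ⊕.sum (λ v → parity (inR' v) xor parity (inB v))
    ≡⟨ ⊕.∑-distrib-+ (parity ∘ inR') (parity ∘ inB) ⟩
  ⊕.sum (parity ∘ inR') xor ⊕.sum (parity ∘ inB)
    ≡⟨ cong₂ _xor_ (parity-sumFin inR') (parity-sumFin inB) ⟨
  parity (card R') xor parity (sumOver side α)
    ≡⟨ parity-+ (card R') (sumOver side α) ⟨
  parity (card R' + sumOver side α)
    ≡⟨ even⇒parity≡false even ⟩
  false
    ∎
  where
  open ≡-Reasoning
  inR' inB : _ → ℕ
  inR' v = if R' v then 1 else 0
  inB v = if side v then α v else 0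
  split : ∀ r s a → (r ≡ true → s ≡ false) →
          (if s then parity a else r) ≡ parity (if r then 1 else 0) xor parity (if s then a else 0)
  split true true a r⇒¬s with () ← r⇒¬s refl
  split true false a _ = refl
  split false true a _ = refl
  split false false a _ = refl

module Weighting {n : ℕ} (G : Graph n) (side R' : Fin n → Bool) (α : Fin n → ℕ)
                 (tj : TJoin G (target side R' α)) (pins : Fin n → List (Fin n)) where
  open TJoin tj

  joinEdge : Fin n → Fin n → Bool
  joinEdge b u = adj G b u ∧ join b u

  startSign : Fin n → Bool
  startSign b = does (α b ≟ℕ 2 * deg G b + 1)

  signAt : Fin n → Fin n → Bool
  signAt b = alternating (startSign b) (pins b ++ allFin n) (joinEdge b)

  localWeight : Fin n → Fin n → ℕ
  localWeight b u = weight (join b u) (signAt b u)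

  ω : Fin n → Fin n → ℕ
  ω u v = if side u then localWeight u v else localWeight v u

  ω-fromB : ∀ {b} → side b ≡ true → ∀ u → ω b u ≡ localWeight b u
  ω-fromB sb u rewrite sb = refl

  ω-fromR : ∀ {v} → side v ≡ false → ∀ u → ω v u ≡ localWeight u v
  ω-fromR sv u rewrite sv = refl

  ω-toB : IsBipartition G side → ∀ {u b} → Adj G u b → side b ≡ true → ω u b ≡ localWeight b u
  ω-toB bip {u} {b} ub sb =
    ω-fromR (trans (opposite-side {G = G} bip (trans (Graph.sym G b u) ub)) (cong not sb)) b

  wdeg-B : ∀ {b} → side b ≡ true →
           + wdeg G ω b ≡ + (2 * deg G b) +ℤ imbalance (startSign b) (⊕.sum (joinEdge b))
  wdeg-B {b} sb = begin
    + wdeg G ω b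
      ≡⟨ +-sumFin (λ u → if adj G b u then ω b u else 0) ⟩
    Σℤ.sum (λ u → + (if adj G b u then ω b u else 0))
      ≡⟨ Σℤ.sum-cong-≗ (λ u → trans (cong (λ w → + (if adj G b u then w else 0)) (ω-fromB sb u))
                                    (weight-on-edge (adj G b u) (join b u) (signAt b u))) ⟩
    Σℤ.sum (λ u → twice u +ℤ imbalance (signAt b u) (joinEdge b u))
      ≡⟨ Σℤ.∑-distrib-+ twice (λ u → imbalance (signAt b u) (joinEdge b u)) ⟩
    Σℤ.sum twice +ℤ signedSum (joinEdge b) (signAt b)
      ≡⟨ cong₂ _+ℤ_ degree (signedSum-alternating (startSign b) (pins b ++ allFin n) (joinEdge b)
                                                  (λ u _ → ∈-++⁺ʳ (pins b) (∈-allFin u))) ⟩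
    + (2 * deg G b) +ℤ imbalance (startSign b) (⊕.sum (joinEdge b))
      ∎
    where
    open ≡-Reasoning
    twice : Fin n → ℤ
    twice u = + (if adj G b u then 2 else 0)
    degree : Σℤ.sum twice ≡ + (2 * deg G b)
    degree = begin
      Σℤ.sum twice                    ≡⟨ Σℤ.sum-cong-≗ (λ u → cong +_ (sym (if-float (2 *_) (adj G b u)))) ⟩
      Σℤ.sum (λ u → + (2 * isAdj u))  ≡⟨ +-sumFin (λ u → 2 * isAdj u) ⟨
      + sumFin (λ u → 2 * isAdj u)    ≡⟨ cong +_ (*-distribˡ-sumFin 2 isAdj) ⟨
      + (2 * deg G b)                 ∎
      where
      isAdj : Fin n → ℕ
      isAdj u = if adj G b u then 1 else 0

  parity-wdeg-R : ∀ {v} → side v ≡ false → parity (wdeg G ω v) ≡ ⊕.sum (joinEdge v)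
  parity-wdeg-R {v} sv =
    trans (parity-sumFin (λ u → if adj G v u then ω v u else 0)) (⊕.sum-cong-≗ summand)
    where
    summand : ∀ u → parity (if adj G v u then ω v u else 0) ≡ adj G v u ∧ join v u
    summand u with adj G v u
    ... | false = refl
    ... | true = trans (cong parity (ω-fromR sv u)) (trans (parity-weight (join u v) _) (join-sym u v))

  good : IsBipartition G side →
         (∀ v → side v ≡ true →
           (α v ≡ 2 * deg G v ∸ 1 ⊎ α v ≡ 2 * deg G v) ⊎ α v ≡ 2 * deg G v + 1) →
         (∀ v → R' v ≡ true → side v ≡ false) → Good G side R' α ω
  good bip near R'⊆R = weighting , even , odd , exact
    where
    onR : ∀ {v} → side v ≡ false → parity (wdeg G ω v) ≡ R' v
    onR {v} sv = trans (parity-wdeg-R sv) (trans (join-degree v) (cong (λ s → if s then _ else R' v) sv))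
    fromB : ∀ {b u} → side b ≡ true → Adj G b u → In123 (ω b u) × ω b u ≡ ω u b
    fromB {b} {u} sb bu = subst In123 (sym (ω-fromB sb u)) (weight-In123 _ _)
                        , trans (ω-fromB sb u) (sym (ω-toB bip (trans (Graph.sym G u b) bu) sb))
    weighting : IsWeighting123 G ω
    weighting u v uv with B-endpoint {G = G} bip uv
    ... | inj₁ su = fromB su uv
    ... | inj₂ sv with fromB sv (trans (Graph.sym G v u) uv)
    ...   | in123 , vu≡uv = subst In123 vu≡uv in123 , sym vu≡uv
    even : ∀ v → side v ≡ false → R' v ≡ false → Even (wdeg G ω v)
    even v sv rv = parity≡false⇒even _ (trans (onR sv) rv)
    odd : ∀ v → R' v ≡ true → Odd (wdeg G ω v)
    odd v rv = parity≡true⇒odd (trans (onR (R'⊆R v rv)) rv)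
    exact : ∀ b → side b ≡ true → wdeg G ω b ≡ α b
    exact b sb = ℤ.+-injective (begin
      + wdeg G ω b
        ≡⟨ wdeg-B sb ⟩
      + (2 * deg G b) +ℤ imbalance (startSign b) (⊕.sum (joinEdge b))
        ≡⟨ cong (λ t → + (2 * deg G b) +ℤ imbalance (startSign b) t)
                (trans (join-degree b) (cong (λ s → if s then parity (α b) else _) sb)) ⟩
      + (2 * deg G b) +ℤ imbalance (startSign b) (parity (α b))
        ≡⟨ imbalance-fits (α b) (deg G b) (near b sb) ⟩
      + α b
        ∎)
      where open ≡-Reasoning

  localWeight-first : ∀ {b q qs} → pins b ≡ q ∷ qs → localWeight b q ≡ weight (join b q) (startSign b)
  localWeight-first {b} {q} {qs} e rewrite e =
    cong (weight (join b q)) (alternating-head (startSign b) q (qs ++ allFin n) (joinEdge b))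

  localWeight-second : ∀ {b q q′ qs} → pins b ≡ q ∷ q′ ∷ qs → q′ ≢ q →
                       localWeight b q′ ≡ weight (join b q′) (startSign b xor joinEdge b q)
  localWeight-second {b} {q} {q′} {qs} e q′≢q rewrite e =
    cong (weight (join b q′)) (alternating-second (startSign b) q q′ (qs ++ allFin n) (joinEdge b) q′≢q)

  endOK : ∀ {b q qs} → pins b ≡ q ∷ qs → EndOK G α b (localWeight b q)
  endOK {b} {q} e = subst (EndOK G α b) (sym (localWeight-first e)) (weight-≟-end (join b q))

  interior-In345 : ∀ {b q q′ qs} → Adj G b q → pins b ≡ q ∷ q′ ∷ qs → q′ ≢ q →
                   In345 (localWeight b q + localWeight b q′)
  interior-In345 {b} {q} {q′} bq e q′≢q =
    subst In345 (sym (cong₂ _+_ (localWeight-first e) (trans (localWeight-second e q′≢q) q-on-join)))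
          (weight-pair-In345 (join b q) (join b q′) (startSign b))
    where
    q-on-join : weight (join b q′) (startSign b xor joinEdge b q) ≡
                weight (join b q′) (startSign b xor join b q)
    q-on-join = cong (λ a → weight (join b q′) (startSign b xor (a ∧ join b q))) bq

pathWeighting-PathOK :
  ∀ {n k} (G : Graph n) (side R' : Fin n → Bool) (α : Fin n → ℕ) (tj : TJoin G (target side R' α)) →
  IsBipartition G side → (p : Fin k → Fin n) (path : IsPath G p) →
  (∀ i → toℕ i ≡ 0 → side (p i) ≡ true) → (∀ i → suc (toℕ i) ≡ k → side (p i) ≡ true) →
  PathOK G side α p (Weighting.ω G side R' α tj (PathPositions.pins p (proj₁ path)))
pathWeighting-PathOK {k = k} G side R' α tj bip p (p-injective , p-adj) start end =
  first , interior , last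
  where
  open PathPositions p p-injective
  open Weighting G side R' α tj pins
  first : ∀ a b → toℕ a ≡ 0 → toℕ b ≡ 1 → EndOK G α (p a) (ω (p a) (p b))
  first a b a≡0 b≡1 = subst (EndOK G α (p a)) (sym (ω-fromB (start a a≡0) (p b)))
                            (endOK (proj₂ (pins-first a b a≡0 b≡1)))
  last : ∀ a b → suc (toℕ a) ≡ toℕ b → suc (toℕ b) ≡ k → EndOK G α (p b) (ω (p a) (p b))
  last a b a+1≡b b+1≡k =
    subst (EndOK G α (p b)) (sym (ω-toB bip (p-adj a b (sym a+1≡b)) (end b b+1≡k)))
          (endOK (proj₂ (pins-last a b a+1≡b)))
  interior : ∀ h i j → toℕ i ≡ suc (toℕ h) → toℕ j ≡ suc (toℕ i) → side (p i) ≡ true →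
             In345 (ω (p h) (p i) + ω (p i) (p j))
  interior h i j i≡h+1 j≡i+1 si =
    subst In345 (sym (cong₂ _+_ (ω-toB bip hi si) (ω-fromB si (p j))))
          (interior-In345 (trans (Graph.sym G (p i) (p h)) hi) (pins-interior h i j i≡h+1 j≡i+1) pj≢ph)
    where
    hi : Adj G (p h) (p i)
    hi = p-adj h i i≡h+1
    pj≢ph : p j ≢ p h
    pj≢ph pj≡ph = ℕ.<⇒≢ (ℕ.m<n⇒m<1+n (ℕ.n<1+n (toℕ h)))
                        (trans (sym (cong toℕ (p-injective pj≡ph))) (trans j≡i+1 (cong suc i≡h+1)))

lemma4 : {n : ℕ} (G : Graph n) → Connected G →
    (side : Fin n → Bool) → IsBipartition G side →
    (α : Fin n → ℕ) →
    (∀ v → side v ≡ true →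
      (α v ≡ 2 * deg G v ∸ 1 ⊎ α v ≡ 2 * deg G v) ⊎ α v ≡ 2 * deg G v + 1) →
    (R' : Fin n → Bool) → (∀ v → R' v ≡ true → side v ≡ false) →
    Even (card R' + sumOver side α) →
    (∃ λ ω → Good G side R' α ω) ×
    (∀ (k : ℕ) (p : Fin k → Fin n) → 3 ≤ k → IsPath G p →
      (∀ i → toℕ i ≡ 0 → side (p i) ≡ true) →
      (∀ i → suc (toℕ i) ≡ k → side (p i) ≡ true) →
      ∃ λ ω → Good G side R' α ω × PathOK G side α p ω)
lemma4 G conn side bip α near R' R'⊆R even =
  (ω (λ _ → []) , good (λ _ → []) bip near R'⊆R) , along
  where
  tj : TJoin G (target side R' α)
  tj = tJoin G conn (target side R' α) (target-balanced side R' α R'⊆R even)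
  open Weighting G side R' α tj
  along : ∀ k (p : Fin k → Fin _) → 3 ≤ k → (path : IsPath G p) →
          (∀ i → toℕ i ≡ 0 → side (p i) ≡ true) →
          (∀ i → suc (toℕ i) ≡ k → side (p i) ≡ true) →
          ∃ λ ω → Good G side R' α ω × PathOK G side α p ω
  along k p _ path start end =
    let pins = PathPositions.pins p (proj₁ path) in
    ω pins , good pins bip near R'⊆R , pathWeighting-PathOK G side R' α tj bip p path start end
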